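{- For all integers $n \geq 1$ and $j \geq 0$, $$FO_{j,2}(n) = FD_{j,2}(n),$$ where $FO_{j,2}(n)$ is the number of partitions of perimeter $n$ having exactly $j$ distinct even part sizes, and $FD_{j,2}(n)$ is the number of partitions of perimeter $n$ having exactly $j$ distinct part sizes that each appear at least $2$ times.
   Context: A partition is a finite nonincreasing sequence of positive integers (its parts); partitions of any size are allowed. For a partition $\pi$, let $\alpha(\pi)$ be its largest part and $\lambda(\pi)$ its number of parts. The perimeter of $\pi$ is $\alpha(\pi)+\lambda(\pi)-1$ (the largest hook length of its Ferrers diagram). For $FO_{j,2}(n)$, "exactly $j$ parts divisible by $2$" counts part sizes: the number of distinct even values occurring among the parts is $j$ (each may be repeated). For $FD_{j,2}(n)$, the number of distinct values occurring with multiplicity at least $2$ is $j$. -}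

module Defs where

open import Data.Nat using (ℕ; _+_; _∸_; _≤_; _≤?_; _≟_)
open import Data.Nat.Divisibility using (_∣?_)
open import Data.List using (List; []; _∷_; length; filter; deduplicate)
open import Data.List.Relation.Unary.All using (All)
open import Data.List.Relation.Unary.Linked using (Linked)
open import Data.Product using (Σ; _×_)
open import Relation.Binary.PropositionalEquality using (_≡_)
open import Relation.Nullary.Decidable using (¬?)

IsPartition : List ℕ → Set
IsPartition l = All (1 ≤_) l × Linked (λ a b → b ≤ a) l

largest : List ℕ → ℕ
largest []      = 0
largest (a ∷ _) = a

-- perimeter α(π) + λ(π) - 1 (truncated subtraction; only matters for the
-- empty partition, which has perimeter 0 here and is excluded by n ≥ 1)
perimeter : List ℕ → ℕ
perimeter l = largest l + length l ∸ 1

distinctValues : List ℕ → List ℕ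
distinctValues l = deduplicate _≟_ l

mult : ℕ → List ℕ → ℕ
mult v l = length (filter (_≟ v) l)

evenSizes : List ℕ → ℕ
evenSizes l = length (filter (2 ∣?_) (distinctValues l))

repeatedSizes : List ℕ → ℕ
repeatedSizes l = length (filter (λ v → 2 ≤? mult v l) (distinctValues l))

FO : ℕ → ℕ → Set
FO j n = Σ (List ℕ) (λ l → IsPartition l × perimeter l ≡ n × evenSizes l ≡ j)

FD : ℕ → ℕ → Set
FD j n = Σ (List ℕ) (λ l → IsPartition l × perimeter l ≡ n × repeatedSizes l ≡ j)

{-# OPTIONS --safe #-}
-- Read a partition through its multiplicity list D = (m_a, …, m_1), where a is the
-- largest part and m_i the multiplicity of i.  Then m_a ≥ 1, the perimeter plus one
-- is Σ (m_i + 1), a distinct even part size is a nonzero entry m_i with i even, and a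
-- repeated part size is an entry m_i ≥ 2.  On multiplicity lists, replace every
-- nonzero entry m, together with the run of k zeros in front of it, by the pair
-- (k, m − 1), and append the length of the final run of zeros.  This preserves
-- Σ (m_i + 1), and since the result ends in a single run length, the entries m − 1
-- land exactly on the even positions: entries m ≥ 2 become nonzero entries at even
-- positions.  The first entry m_a is treated separately so that the image again
-- starts with a positive entry.
module Submission where

open import Defs
open import Data.Nat using (ℕ; zero; suc; pred; _+_; _∸_; _≤_; _≥_; _<_; _≟_; _≤?_; s≤s; z≤n)
open import Data.Nat.Properties
  using ( ≤-refl; ≤-trans; ≤-<-trans; ≤-pred; ≤∧≢⇒<; m≤n⇒m≤1+n; <⇒≢; >⇒≢
        ; +-suc; +-comm; +-identityʳ; +-commutativeSemigroup; ≤-irrelevant; ≡-irrelevant)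
open import Data.Nat.Divisibility
  using (_∣_; _∤_; _∣?_; ∣-refl; _∣0; ∣1⇒≡1; ∣m∣n⇒∣m+n; ∣m+n∣m⇒∣n)
open import Algebra.Properties.CommutativeSemigroup +-commutativeSemigroup using (x∙yz≈y∙xz)
open import Data.Bool using (true; false; if_then_else_)
open import Data.List
  using (List; []; _∷_; [_]; _++_; length; replicate; filter; deduplicate; applyDownFrom)
open import Data.List.Properties
  using (length-++; length-replicate; ++-identityʳ; filter-accept; filter-reject; filter-all; filter-none)
open import Data.List.Relation.Unary.All as All using (All; []; _∷_)
open import Data.List.Relation.Unary.All.Properties using (++⁺; ++⁻ʳ; replicate⁺; deduplicate⁺)
open import Data.List.Relation.Unary.Linked as Linked using (Linked; []; [-]; _∷_)
open import Data.List.Relation.Unary.Linked.Properties using (Linked⇒All)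
open import Data.Product using (Σ; Σ-syntax; _×_; _,_)
open import Data.Unit using (⊤; tt)
open import Function using (_∘_)
open import Function.Bundles using (_↔_; mk↔ₛ′)
open import Function.Properties.Inverse using (↔-trans; ↔-sym)
open import Relation.Binary.PropositionalEquality
  using (_≡_; _≢_; refl; sym; trans; cong; cong₂; subst; module ≡-Reasoning)
open import Relation.Nullary using (yes; no; does; contradiction)
open import Relation.Nullary.Decidable using (¬?; dec-true; dec-false)
open import Relation.Unary using (Decidable; Irrelevant)

-- Counting through a correspondence

Counted : {A : Set} → (A → Set) → (A → ℕ) → (A → ℕ) → ℕ → ℕ → Set
Counted {A} R size stat n j = Σ A λ x → R x × size x ≡ n × stat x ≡ j

record Correspondence {A B : Set} (R : A → Set) (S : B → Set) : Set where
  field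
    to      : A → B
    from    : B → A
    to-∈    : ∀ {x} → R x → S (to x)
    from-∈  : ∀ {y} → S y → R (from y)
    from∘to : ∀ {x} → R x → from (to x) ≡ x
    to∘from : ∀ {y} → S y → to (from y) ≡ y

Counted-↔ : {A B : Set} {R : A → Set} {S : B → Set}
            {size stat : A → ℕ} {size′ stat′ : B → ℕ} →
            Irrelevant R → Irrelevant S → (c : Correspondence R S) →
            (∀ {y} → S y → size (Correspondence.from c y) ≡ size′ y) →
            (∀ {y} → S y → stat (Correspondence.from c y) ≡ stat′ y) →
            ∀ {n j} → Counted R size stat n j ↔ Counted S size′ stat′ n j
Counted-↔ {R = R} {S} {size} {stat} {size′} {stat′} R-irr S-irr c size-from stat-from {n} {j} =
  mk↔ₛ′ forth back (λ (_ , s , _) → Σ-≡ S-irr (to∘from s))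
                   (λ (_ , r , _) → Σ-≡ R-irr (from∘to r))
  where
  open Correspondence c

  transfer : (f : _ → ℕ) (f′ : _ → ℕ) → (∀ {y} → S y → f (from y) ≡ f′ y) →
             ∀ {x} → R x → f′ (to x) ≡ f x
  transfer f f′ f-from r = trans (sym (f-from (to-∈ r))) (cong f (from∘to r))

  forth : Counted R size stat n j → Counted S size′ stat′ n j
  forth (x , r , p , q) =
    to x , to-∈ r , trans (transfer size size′ size-from r) p , trans (transfer stat stat′ stat-from r) q

  back : Counted S size′ stat′ n j → Counted R size stat n j
  back (y , s , p , q) = from y , from-∈ s , trans (size-from s) p , trans (stat-from s) q

  Σ-≡ : ∀ {C : Set} {T : C → Set} {f g : C → ℕ} → Irrelevant T → ∀ {x y} → x ≡ y →
        ∀ {u : T x × f x ≡ n × g x ≡ j} {v : T y × f y ≡ n × g y ≡ j} → (x , u) ≡ (y , v)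
  Σ-≡ T-irr {x} refl {t , p , q} {t′ , p′ , q′} =
    cong (x ,_) (cong₂ _,_ (T-irr t t′) (cong₂ _,_ (≡-irrelevant p p′) (≡-irrelevant q q′)))

-- Partitions as multiplicity lists

HeadPositive : List ℕ → Set
HeadPositive []      = ⊤
HeadPositive (m ∷ _) = 1 ≤ m

HeadPositive-irrelevant : Irrelevant HeadPositive
HeadPositive-irrelevant {[]}    tt tt = refl
HeadPositive-irrelevant {_ ∷ _} p  q  = ≤-irrelevant p q

IsPartition-irrelevant : Irrelevant IsPartition
IsPartition-irrelevant (pos , desc) (pos′ , desc′) =
  cong₂ _,_ (All.irrelevant ≤-irrelevant pos pos′) (Linked.irrelevant ≤-irrelevant desc desc′)

weight : List ℕ → ℕ
weight []      = 0
weight (m ∷ D) = suc m + weight D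

partitionOf : List ℕ → List ℕ
partitionOf []      = []
partitionOf (m ∷ D) = replicate m (suc (length D)) ++ partitionOf D

multiplicitiesUpTo : ℕ → List ℕ → List ℕ
multiplicitiesUpTo v l = applyDownFrom (λ i → mult (suc i) l) v

multiplicities : List ℕ → List ℕ
multiplicities l = multiplicitiesUpTo (largest l) l

partitionOf-bounded : ∀ D → All (_≤ length D) (partitionOf D)
partitionOf-bounded []      = []
partitionOf-bounded (m ∷ D) =
  ++⁺ (replicate⁺ m ≤-refl) (All.map m≤n⇒m≤1+n (partitionOf-bounded D))

descending⇒≤head : ∀ {x l} → Linked _≥_ (x ∷ l) → All (_≤ x) (x ∷ l)
descending⇒≤head = Linked⇒All (λ y≤x z≤y → ≤-trans z≤y y≤x) ≤-refl

replicate-++-descending : ∀ m {w ys} → All (_≤ w) ys → Linked _≥_ ys →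
                          Linked _≥_ (replicate m w ++ ys)
replicate-++-descending zero          _         desc = desc
replicate-++-descending (suc zero)    []        _    = [-]
replicate-++-descending (suc zero)    (y≤w ∷ _) desc = y≤w ∷ desc
replicate-++-descending (suc (suc m)) ys≤w      desc = ≤-refl ∷ replicate-++-descending (suc m) ys≤w desc

partitionOf-isPartition : ∀ D → IsPartition (partitionOf D)
partitionOf-isPartition []      = [] , []
partitionOf-isPartition (m ∷ D) with partitionOf-isPartition D
... | pos , desc =
  ++⁺ (replicate⁺ m (s≤s z≤n)) pos ,
  replicate-++-descending m (All.map m≤n⇒m≤1+n (partitionOf-bounded D)) desc

length-partitionOf : ∀ D → length D + length (partitionOf D) ≡ weight D
length-partitionOf []      = refl
length-partitionOf (m ∷ D) = cong suc (begin
  length D + length (replicate m _ ++ pD)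
    ≡⟨ cong (length D +_) (length-++ (replicate m _)) ⟩
  length D + (length (replicate m _) + length pD)
    ≡⟨ cong (λ k → length D + (k + length pD)) (length-replicate m) ⟩
  length D + (m + length pD)
    ≡⟨ x∙yz≈y∙xz (length D) m (length pD) ⟩
  m + (length D + length pD)
    ≡⟨ cong (m +_) (length-partitionOf D) ⟩
  m + weight D ∎)
  where
  open ≡-Reasoning
  pD = partitionOf D

perimeter-partitionOf : ∀ {D} → HeadPositive D → perimeter (partitionOf D) ≡ weight D ∸ 1
perimeter-partitionOf {[]}        _ = refl
perimeter-partitionOf {suc m ∷ D} _ = cong (_∸ 1) (length-partitionOf (suc m ∷ D))

mult-replicate-++-self : ∀ w k ys → mult w (replicate k w ++ ys) ≡ k + mult w ys
mult-replicate-++-self w zero    ys = refl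
mult-replicate-++-self w (suc k) ys =
  trans (cong length (filter-accept (_≟ w) refl)) (cong suc (mult-replicate-++-self w k ys))

mult-replicate-++-other : ∀ {v w} k ys → w ≢ v → mult v (replicate k w ++ ys) ≡ mult v ys
mult-replicate-++-other zero    ys w≢v = refl
mult-replicate-++-other (suc k) ys w≢v =
  trans (cong length (filter-reject (_≟ _) w≢v)) (mult-replicate-++-other k ys w≢v)

mult-absent : ∀ {v ys} → All (_≢ v) ys → mult v ys ≡ 0
mult-absent absent = cong length (filter-none (_≟ _) absent)

mult-partitionOf-top : ∀ m D → mult (suc (length D)) (partitionOf (m ∷ D)) ≡ m
mult-partitionOf-top m D = begin
  mult w (replicate m w ++ pD)
    ≡⟨ mult-replicate-++-self w m pD ⟩
  m + mult w pD
    ≡⟨ cong (m +_) (mult-absent (All.map (<⇒≢ ∘ s≤s) (partitionOf-bounded D))) ⟩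
  m + 0
    ≡⟨ +-identityʳ m ⟩
  m ∎
  where
  open ≡-Reasoning
  w  = suc (length D)
  pD = partitionOf D

mult-partitionOf-below : ∀ m D {v} → v ≤ length D →
                         mult v (partitionOf (m ∷ D)) ≡ mult v (partitionOf D)
mult-partitionOf-below m D v≤L = mult-replicate-++-other m (partitionOf D) (>⇒≢ (s≤s v≤L))

applyDownFrom-cong : ∀ {A : Set} {f g : ℕ → A} n → (∀ {i} → i < n → f i ≡ g i) →
                     applyDownFrom f n ≡ applyDownFrom g n
applyDownFrom-cong zero    f≗g = refl
applyDownFrom-cong (suc n) f≗g = cong₂ _∷_ (f≗g ≤-refl) (applyDownFrom-cong n (f≗g ∘ m≤n⇒m≤1+n))

multiplicitiesUpTo-partitionOf : ∀ D → multiplicitiesUpTo (length D) (partitionOf D) ≡ D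
multiplicitiesUpTo-partitionOf []      = refl
multiplicitiesUpTo-partitionOf (m ∷ D) =
  cong₂ _∷_ (mult-partitionOf-top m D)
            (trans (applyDownFrom-cong (length D) (mult-partitionOf-below m D))
                   (multiplicitiesUpTo-partitionOf D))

descending-split : ∀ w {l} → Linked _≥_ l → All (_≤ w) l →
                   Σ[ c ∈ ℕ ] Σ[ l′ ∈ List ℕ ]
                     l ≡ replicate c w ++ l′ × Linked _≥_ l′ × All (_< w) l′
descending-split w {[]}    _    _           = 0 , [] , refl , [] , []
descending-split w {x ∷ l} desc (x≤w ∷ l≤w) with x ≟ w
... | yes refl with descending-split w (Linked.tail desc) l≤w
...   | c , l′ , refl , desc′ , l′<w = suc c , l′ , refl , desc′ , l′<w
descending-split w {x ∷ l} desc (x≤w ∷ l≤w) | no x≢w =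
  0 , x ∷ l , refl , desc ,
  All.map (λ y≤x → ≤-<-trans y≤x (≤∧≢⇒< x≤w x≢w)) (descending⇒≤head desc)

partitionOf-onto : ∀ v {l} → All (1 ≤_) l → Linked _≥_ l → All (_≤ v) l →
                   Σ[ D ∈ List ℕ ] length D ≡ v × partitionOf D ≡ l
partitionOf-onto zero    {[]}    _         _    _         = [] , refl , refl
partitionOf-onto zero    {x ∷ _} (1≤x ∷ _) _    (x≤0 ∷ _) = contradiction (≤-trans 1≤x x≤0) λ ()
partitionOf-onto (suc v) pos desc l≤v with descending-split (suc v) desc l≤v
... | c , l′ , refl , desc′ , l′<w
    with partitionOf-onto v (++⁻ʳ (replicate c _) pos) desc′ (All.map ≤-pred l′<w)
...   | D , refl , refl = c ∷ D , refl , refl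

partitionOf-multiplicities : ∀ {l} → IsPartition l → partitionOf (multiplicities l) ≡ l
partitionOf-multiplicities {[]}    _            = refl
partitionOf-multiplicities {a ∷ l} (pos , desc) with partitionOf-onto a pos desc (descending⇒≤head desc)
... | D , refl , D↦l = begin
  partitionOf (multiplicitiesUpTo (length D) (length D ∷ l))
    ≡⟨ cong (partitionOf ∘ multiplicitiesUpTo (length D)) (sym D↦l) ⟩
  partitionOf (multiplicitiesUpTo (length D) (partitionOf D))
    ≡⟨ cong partitionOf (multiplicitiesUpTo-partitionOf D) ⟩
  partitionOf D
    ≡⟨ D↦l ⟩
  length D ∷ l ∎
  where open ≡-Reasoning

multiplicities-partitionOf : ∀ {D} → HeadPositive D → multiplicities (partitionOf D) ≡ D
multiplicities-partitionOf {[]}        _ = refl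
multiplicities-partitionOf {suc m ∷ D} _ = multiplicitiesUpTo-partitionOf (suc m ∷ D)

multiplicities-headPositive : ∀ {l} → IsPartition l → HeadPositive (multiplicities l)
multiplicities-headPositive {[]}        _            = tt
multiplicities-headPositive {zero ∷ _}  (() ∷ _ , _)
multiplicities-headPositive {suc a ∷ l} _            =
  subst (1 ≤_) (sym (mult-replicate-++-self (suc a) 1 l)) (s≤s z≤n)

partitions≅multiplicities : Correspondence IsPartition HeadPositive
partitions≅multiplicities = record
  { to      = multiplicities
  ; from    = partitionOf
  ; to-∈    = multiplicities-headPositive
  ; from-∈  = λ {D} _ → partitionOf-isPartition D
  ; from∘to = partitionOf-multiplicities
  ; to∘from = multiplicities-partitionOf
  }

-- The two statistics on multiplicity lists

support : List ℕ → List ℕ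
support []          = []
support (zero ∷ D)  = support D
support (suc _ ∷ D) = suc (length D) ∷ support D

support-bounded : ∀ D → All (_≤ length D) (support D)
support-bounded []          = []
support-bounded (zero ∷ D)  = All.map m≤n⇒m≤1+n (support-bounded D)
support-bounded (suc _ ∷ D) = ≤-refl ∷ All.map m≤n⇒m≤1+n (support-bounded D)

deduplicate-replicate-++ : ∀ m {w ys} → All (w ≢_) ys →
                           deduplicate _≟_ (replicate (suc m) w ++ ys) ≡ w ∷ deduplicate _≟_ ys
deduplicate-replicate-++ zero    {w}      absent =
  cong (w ∷_) (filter-all (¬? ∘ (w ≟_)) (deduplicate⁺ _≟_ absent))
deduplicate-replicate-++ (suc m) {w} {ys} absent = cong (w ∷_) (begin
  filter ≢w? (deduplicate _≟_ (replicate (suc m) w ++ ys))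
    ≡⟨ cong (filter ≢w?) (deduplicate-replicate-++ m absent) ⟩
  filter ≢w? (w ∷ deduplicate _≟_ ys)
    ≡⟨ filter-reject ≢w? (λ w≢w → w≢w refl) ⟩
  filter ≢w? (deduplicate _≟_ ys)
    ≡⟨ filter-all ≢w? (deduplicate⁺ _≟_ absent) ⟩
  deduplicate _≟_ ys ∎)
  where
  open ≡-Reasoning
  ≢w? = ¬? ∘ (w ≟_)

distinctValues-partitionOf : ∀ D → distinctValues (partitionOf D) ≡ support D
distinctValues-partitionOf []          = refl
distinctValues-partitionOf (zero ∷ D)  = distinctValues-partitionOf D
distinctValues-partitionOf (suc m ∷ D) =
  trans (deduplicate-replicate-++ m (All.map (>⇒≢ ∘ s≤s) (partitionOf-bounded D)))
        (cong (suc (length D) ∷_) (distinctValues-partitionOf D))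

evenSupport : List ℕ → ℕ
evenSupport D = length (filter (2 ∣?_) (support D))

evenSizes-partitionOf : ∀ D → evenSizes (partitionOf D) ≡ evenSupport D
evenSizes-partitionOf D = cong (length ∘ filter (2 ∣?_)) (distinctValues-partitionOf D)

repeatedEntries : List ℕ → ℕ
repeatedEntries D = length (filter (2 ≤?_) D)

filter-cong-All : ∀ {A B : Set} {P : B → Set} (P? : Decidable P) {f g : A → B} {xs} →
                  All (λ x → f x ≡ g x) xs → filter (P? ∘ f) xs ≡ filter (P? ∘ g) xs
filter-cong-All P? []                          = refl
filter-cong-All P? {g = g} {x ∷ _} (fx≡gx ∷ f≗g) rewrite fx≡gx with does (P? (g x))
... | true  = cong (x ∷_) (filter-cong-All P? f≗g)
... | false = filter-cong-All P? f≗g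

length-filter-∘-∷ : ∀ {A B : Set} {P : B → Set} (P? : Decidable P) (f : A → B) x xs →
                    length (filter (P? ∘ f) (x ∷ xs)) ≡
                    length (filter P? [ f x ]) + length (filter (P? ∘ f) xs)
length-filter-∘-∷ P? f x xs with does (P? (f x))
... | true  = refl
... | false = refl

repeatedAmong : List ℕ → List ℕ → ℕ
repeatedAmong l S = length (filter (λ v → 2 ≤? mult v l) S)

repeatedAmong-support : ∀ D → repeatedAmong (partitionOf D) (support D) ≡ repeatedEntries D
repeatedAmong-support []          = refl
repeatedAmong-support (zero ∷ D)  = repeatedAmong-support D
repeatedAmong-support (suc m ∷ D) = begin
  repeatedAmong l (w ∷ support D)
    ≡⟨ length-filter-∘-∷ (2 ≤?_) (λ v → mult v l) w (support D) ⟩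
  atLeast2 (mult w l) + repeatedAmong l (support D)
    ≡⟨ cong₂ _+_ (cong atLeast2 (mult-partitionOf-top (suc m) D)) (cong length smaller-sizes) ⟩
  atLeast2 (suc m) + repeatedAmong (partitionOf D) (support D)
    ≡⟨ cong (atLeast2 (suc m) +_) (repeatedAmong-support D) ⟩
  atLeast2 (suc m) + repeatedEntries D
    ≡⟨ sym (length-filter-∘-∷ (2 ≤?_) (λ k → k) (suc m) D) ⟩
  repeatedEntries (suc m ∷ D) ∎
  where
  open ≡-Reasoning
  w = suc (length D)
  l = partitionOf (suc m ∷ D)
  atLeast2 : ℕ → ℕ
  atLeast2 k = length (filter (2 ≤?_) [ k ])
  smaller-sizes : filter (λ v → 2 ≤? mult v l) (support D) ≡
                  filter (λ v → 2 ≤? mult v (partitionOf D)) (support D)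
  smaller-sizes = filter-cong-All (2 ≤?_) (All.map (mult-partitionOf-below (suc m) D) (support-bounded D))

repeatedSizes-partitionOf : ∀ D → repeatedSizes (partitionOf D) ≡ repeatedEntries D
repeatedSizes-partitionOf D =
  trans (cong (repeatedAmong (partitionOf D)) (distinctValues-partitionOf D)) (repeatedAmong-support D)

-- The run-length bijection

2∤1 : 2 ∤ 1
2∤1 2∣1 = contradiction (∣1⇒≡1 2∣1) λ ()

2∣n⇒2∤1+n : ∀ {n} → 2 ∣ n → 2 ∤ suc n
2∣n⇒2∤1+n {n} 2∣n 2∣1+n = 2∤1 (∣m+n∣m⇒∣n (subst (2 ∣_) (+-comm 1 n) 2∣1+n) 2∣n)

2∤1+n⇒2∣n : ∀ {n} → 2 ∤ suc n → 2 ∣ n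
2∤1+n⇒2∣n {zero}        _     = 2 ∣0
2∤1+n⇒2∣n {suc zero}    2∤2   = contradiction ∣-refl 2∤2
2∤1+n⇒2∣n {suc (suc n)} 2∤3+n = ∣m∣n⇒∣m+n ∣-refl (2∤1+n⇒2∣n (2∤3+n ∘ ∣m∣n⇒∣m+n ∣-refl))

-- k is the length of the current run of zeros.
runEncode : ℕ → List ℕ → List ℕ
runEncode k []          = [ k ]
runEncode k (zero ∷ D)  = runEncode (suc k) D
runEncode k (suc z ∷ D) = k ∷ z ∷ runEncode 0 D

runDecode : List ℕ → List ℕ
runDecode []          = []
runDecode (k ∷ [])    = replicate k 0
runDecode (k ∷ z ∷ E) = replicate k 0 ++ suc z ∷ runDecode E

φ : List ℕ → List ℕ
φ []                = []
φ (zero ∷ _)        = []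
φ (suc zero ∷ D)    = runEncode 1 D
φ (suc (suc z) ∷ D) = suc z ∷ runEncode 0 D

-- The parity of the length tells which of the last two clauses of φ produced the list.
ψ : List ℕ → List ℕ
ψ []      = []
ψ (x ∷ E) = if does (2 ∣? length E) then 1 ∷ runDecode (pred x ∷ E) else suc x ∷ runDecode E

runEncode-odd : ∀ k D → 2 ∣ suc (length (runEncode k D))
runEncode-odd k []          = ∣-refl
runEncode-odd k (zero ∷ D)  = runEncode-odd (suc k) D
runEncode-odd k (suc z ∷ D) = ∣m∣n⇒∣m+n ∣-refl (runEncode-odd 0 D)

runEncode-headPositive : ∀ k D → HeadPositive (runEncode (suc k) D)
runEncode-headPositive k []          = s≤s z≤n
runEncode-headPositive k (zero ∷ D)  = runEncode-headPositive (suc k) D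
runEncode-headPositive k (suc z ∷ D) = s≤s z≤n

φ-headPositive : ∀ {D} → HeadPositive D → HeadPositive (φ D)
φ-headPositive {[]}              _ = tt
φ-headPositive {suc zero ∷ D}    _ = runEncode-headPositive 0 D
φ-headPositive {suc (suc z) ∷ D} _ = s≤s z≤n

ψ-headPositive : ∀ E → HeadPositive (ψ E)
ψ-headPositive []      = tt
ψ-headPositive (x ∷ E) with does (2 ∣? length E)
... | true  = s≤s z≤n
... | false = s≤s z≤n

weight-runEncode : ∀ k D → weight (runEncode k D) ≡ suc (k + weight D)
weight-runEncode k []          = refl
weight-runEncode k (zero ∷ D)  =
  trans (weight-runEncode (suc k) D) (cong suc (sym (+-suc k (weight D))))
weight-runEncode k (suc z ∷ D) =
  trans (cong (λ t → suc k + (suc z + t)) (weight-runEncode 0 D))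
        (cong (suc ∘ (k +_)) (+-suc (suc z) (weight D)))

weight-φ : ∀ {D} → HeadPositive D → weight (φ D) ≡ weight D
weight-φ {[]}              _ = refl
weight-φ {suc zero ∷ D}    _ = weight-runEncode 1 D
weight-φ {suc (suc z) ∷ D} _ =
  trans (cong (suc (suc z) +_) (weight-runEncode 0 D)) (+-suc (suc (suc z)) (weight D))

evenSupport-∷-even : ∀ m E → 2 ∣ suc (length E) → evenSupport (suc m ∷ E) ≡ suc (evenSupport E)
evenSupport-∷-even _ _ even = cong length (filter-accept (2 ∣?_) even)

evenSupport-∷-odd : ∀ m {E} → 2 ∤ suc (length E) → evenSupport (m ∷ E) ≡ evenSupport E
evenSupport-∷-odd zero    _   = refl
evenSupport-∷-odd (suc m) odd = cong length (filter-reject (2 ∣?_) odd)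

evenSupport-runEncode : ∀ k D → evenSupport (runEncode k D) ≡ repeatedEntries D
evenSupport-runEncode k []                = evenSupport-∷-odd k 2∤1
evenSupport-runEncode k (zero ∷ D)        = evenSupport-runEncode (suc k) D
evenSupport-runEncode k (suc zero ∷ D)    =
  trans (evenSupport-∷-odd k (2∣n⇒2∤1+n (runEncode-odd 0 D))) (evenSupport-runEncode 0 D)
evenSupport-runEncode k (suc (suc z) ∷ D) =
  trans (evenSupport-∷-odd k (2∣n⇒2∤1+n (runEncode-odd 0 D)))
        (trans (evenSupport-∷-even z (runEncode 0 D) (runEncode-odd 0 D))
               (cong suc (evenSupport-runEncode 0 D)))

evenSupport-φ : ∀ {D} → HeadPositive D → evenSupport (φ D) ≡ repeatedEntries D
evenSupport-φ {[]}              _ = refl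
evenSupport-φ {suc zero ∷ D}    _ = evenSupport-runEncode 1 D
evenSupport-φ {suc (suc z) ∷ D} _ =
  trans (evenSupport-∷-even z (runEncode 0 D) (runEncode-odd 0 D)) (cong suc (evenSupport-runEncode 0 D))

replicate-suc-++ : ∀ {A : Set} k (x : A) xs → replicate (suc k) x ++ xs ≡ replicate k x ++ x ∷ xs
replicate-suc-++ zero    x xs = refl
replicate-suc-++ (suc k) x xs = cong (x ∷_) (replicate-suc-++ k x xs)

runDecode-runEncode : ∀ k D → runDecode (runEncode k D) ≡ replicate k 0 ++ D
runDecode-runEncode k []          = sym (++-identityʳ (replicate k 0))
runDecode-runEncode k (zero ∷ D)  = trans (runDecode-runEncode (suc k) D) (replicate-suc-++ k 0 D)
runDecode-runEncode k (suc z ∷ D) = cong (λ t → replicate k 0 ++ suc z ∷ t) (runDecode-runEncode 0 D)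

runEncode-replicate-++ : ∀ j k ys → runEncode j (replicate k 0 ++ ys) ≡ runEncode (k + j) ys
runEncode-replicate-++ j zero    ys = refl
runEncode-replicate-++ j (suc k) ys =
  trans (runEncode-replicate-++ (suc j) k ys) (cong (λ t → runEncode t ys) (+-suc k j))

runEncode-runDecode : ∀ j k E → 2 ∣ length E → runEncode j (runDecode (k ∷ E)) ≡ k + j ∷ E
runEncode-runDecode j k []           _    =
  trans (cong (runEncode j) (sym (++-identityʳ (replicate k 0)))) (runEncode-replicate-++ j k [])
runEncode-runDecode j k (z ∷ [])     2∣1  = contradiction 2∣1 2∤1
runEncode-runDecode j k (z ∷ k′ ∷ E) even =
  trans (runEncode-replicate-++ j k _)
        (cong (λ t → k + j ∷ z ∷ t)
              (trans (runEncode-runDecode 0 k′ E (∣m+n∣m⇒∣n even ∣-refl))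
                     (cong (_∷ E) (+-identityʳ k′))))

ψ-runEncode-suc : ∀ k D → ψ (runEncode (suc k) D) ≡ 1 ∷ runDecode (runEncode k D)
ψ-runEncode-suc k []          = refl
ψ-runEncode-suc k (zero ∷ D)  = ψ-runEncode-suc (suc k) D
ψ-runEncode-suc k (suc z ∷ D)
  rewrite dec-true (2 ∣? suc (length (runEncode 0 D))) (runEncode-odd 0 D) = refl

ψ∘φ : ∀ {D} → HeadPositive D → ψ (φ D) ≡ D
ψ∘φ {[]}              _ = refl
ψ∘φ {suc zero ∷ D}    _ = trans (ψ-runEncode-suc 0 D) (cong (1 ∷_) (runDecode-runEncode 0 D))
ψ∘φ {suc (suc z) ∷ D} _ rewrite dec-false (2 ∣? length (runEncode 0 D))
                                          (λ 2∣L → 2∣n⇒2∤1+n 2∣L (runEncode-odd 0 D)) =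
  cong (suc (suc z) ∷_) (runDecode-runEncode 0 D)

φ∘ψ : ∀ {E} → HeadPositive E → φ (ψ E) ≡ E
φ∘ψ {[]}        _ = refl
φ∘ψ {suc x ∷ E} _ with 2 ∣? length E
φ∘ψ {suc x ∷ E}     _ | yes even rewrite dec-true (2 ∣? length E) even =
  trans (runEncode-runDecode 1 x E even) (cong (_∷ E) (+-comm x 1))
φ∘ψ {suc x ∷ []}    _ | no  odd  = contradiction (2 ∣0) odd
φ∘ψ {suc x ∷ k ∷ E} _ | no  odd  rewrite dec-false (2 ∣? suc (length E)) odd =
  cong (suc x ∷_) (trans (runEncode-runDecode 0 k E (2∤1+n⇒2∣n odd)) (cong (_∷ E) (+-identityʳ k)))

runLength-correspondence : Correspondence HeadPositive HeadPositive
runLength-correspondence = record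
  { to      = ψ
  ; from    = φ
  ; to-∈    = λ {E} _ → ψ-headPositive E
  ; from-∈  = φ-headPositive
  ; from∘to = φ∘ψ
  ; to∘from = ψ∘φ
  }

theorem1p1 : (n j : ℕ) → 1 ≤ n → FO j n ↔ FD j n
theorem1p1 n j _ = ↔-trans FO↔even (↔-trans even↔repeated (↔-sym FD↔repeated))
  where
  Multiplicities : (List ℕ → ℕ) → Set
  Multiplicities stat = Counted HeadPositive (λ D → weight D ∸ 1) stat n j

  FO↔even : FO j n ↔ Multiplicities evenSupport
  FO↔even = Counted-↔ IsPartition-irrelevant HeadPositive-irrelevant partitions≅multiplicities
              perimeter-partitionOf (λ {D} _ → evenSizes-partitionOf D)

  even↔repeated : Multiplicities evenSupport ↔ Multiplicities repeatedEntries
  even↔repeated = Counted-↔ HeadPositive-irrelevant HeadPositive-irrelevant runLength-correspondence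
                    (cong (_∸ 1) ∘ weight-φ) evenSupport-φ

  FD↔repeated : FD j n ↔ Multiplicities repeatedEntries
  FD↔repeated = Counted-↔ IsPartition-irrelevant HeadPositive-irrelevant partitions≅multiplicities
                  perimeter-partitionOf (λ {D} _ → repeatedSizes-partitionOf D)
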